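{- Let $\mathfrak X$ be the structure with domain $X=\{(a,b,m): a,b\in\mathbb Q, a\neq b, m\in\mathbb Z_4\}$ and binary relations $R=\{((a,b,m),(a,b,m+1))\}$, $E=\{((a,b,m),(c,d,n)) : (a,b)_m=(c,d)_n \text{ and } |\{a,b\}\cap\{c,d\}|=1\}$, $N=\{((a,b,m),(c,d,n)) : \{a,b\}\cap\{c,d\}=\emptyset\}$, where $(a,b)_m$ denotes $a$ if $m$ is even and $b$ if $m$ is odd, and $m+1$ is computed in $\mathbb Z_4$. Let $\mathfrak Y$ be the substructure of $\mathfrak X$ induced on $Y=\{(a,b,m)\in X: a<b\}$. Then $\mathfrak Y$ is the model-complete core of $\mathfrak X$; that is, $\mathfrak Y$ is a model-complete core and $\mathfrak X$ and $\mathfrak Y$ are homomorphically equivalent.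
   Context: A countable $\omega$-categorical structure is a model-complete core if its automorphism group is dense (in the topology of pointwise convergence) in its endomorphism monoid. Two structures are homomorphically equivalent if there are homomorphisms in both directions. -}

module Defs where

open import Data.Rational using (ℚ)
open import Data.Rational.Properties using (_≟_; _<?_)
open import Data.Fin using (Fin; zero; suc)
open import Data.Nat using (ℕ; zero; suc; _+_)
open import Data.Bool using (Bool; true; false; not; T; _∨_)
open import Data.Product using (Σ; _×_; _,_; proj₁; proj₂; ∃)
open import Data.List using (List)
open import Data.List.Relation.Unary.All using (All)
open import Relation.Nullary using (does)
open import Relation.Binary.PropositionalEquality using (_≡_)

record Structure : Set₁ where
  field
    Carrier : Set
    R E N   : Carrier → Carrier → Set
open Structure public

record Hom (A B : Structure) : Set where
  field
    fun    : Carrier A → Carrier B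
    pres-R : ∀ {x y} → R A x y → R B (fun x) (fun y)
    pres-E : ∀ {x y} → E A x y → E B (fun x) (fun y)
    pres-N : ∀ {x y} → N A x y → N B (fun x) (fun y)
open Hom public

record Aut (A : Structure) : Set where
  field
    to      : Hom A A
    from    : Hom A A
    to∘from : ∀ x → fun to (fun from x) ≡ x
    from∘to : ∀ x → fun from (fun to x) ≡ x
open Aut public

-- Aut(A) is dense in End(A) w.r.t. the topology of pointwise convergence:
-- every endomorphism agrees with some automorphism on any finite set of points.
ModelCompleteCore : Structure → Set
ModelCompleteCore A =
  (e : Hom A A) (xs : List (Carrier A)) →
  Σ (Aut A) λ α → All (λ x → fun (to α) x ≡ fun e x) xs

HomEquivalent : Structure → Structure → Set
HomEquivalent A B = Hom A B × Hom B A

suc4 : Fin 4 → Fin 4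
suc4 zero = suc zero
suc4 (suc zero) = suc (suc zero)
suc4 (suc (suc zero)) = suc (suc (suc zero))
suc4 (suc (suc (suc zero))) = zero

even4 : Fin 4 → Bool
even4 zero = true
even4 (suc zero) = false
even4 (suc (suc zero)) = true
even4 (suc (suc (suc zero))) = false

sel : ℚ → ℚ → Fin 4 → ℚ
sel a b m with even4 m
... | true  = a
... | false = b

-- X = {(a,b,m) : a ≠ b}  (a ≠ b recorded as a Boolean test, proof-irrelevant)
X : Set
X = Σ (ℚ × ℚ × Fin 4) λ { (a , b , m) → T (not (does (a ≟ b))) }

fst₁ snd₁ : X → ℚ
fst₁ ((a , b , m) , _) = a
snd₁ ((a , b , m) , _) = b
idx : X → Fin 4
idx ((a , b , m) , _) = m

mem : ℚ → ℚ → ℚ → Bool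
mem x c d = does (x ≟ c) ∨ does (x ≟ d)

count : Bool → ℕ
count true = 1
count false = 0

-- |{a,b} ∩ {c,d}|  (correct since a ≠ b)
inter : X → X → ℕ
inter x y = count (mem (fst₁ x) (fst₁ y) (snd₁ y)) + count (mem (snd₁ x) (fst₁ y) (snd₁ y))

RX EX NX : X → X → Set
RX x y = (fst₁ x ≡ fst₁ y) × (snd₁ x ≡ snd₁ y) × (suc4 (idx x) ≡ idx y)
EX x y = (sel (fst₁ x) (snd₁ x) (idx x) ≡ sel (fst₁ y) (snd₁ y) (idx y)) × (inter x y ≡ 1)
NX x y = inter x y ≡ 0

𝔛 : Structure
𝔛 = record { Carrier = X ; R = RX ; E = EX ; N = NX }

Y : Set
Y = Σ X λ x → T (does (fst₁ x <? snd₁ x))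

𝔜 : Structure
𝔜 = record
  { Carrier = Y
  ; R = λ x y → RX (proj₁ x) (proj₁ y)
  ; E = λ x y → EX (proj₁ x) (proj₁ y)
  ; N = λ x y → NX (proj₁ x) (proj₁ y)
  }

-- An endomorphism e of 𝔜 commutes with the R-successor, and two points with the same
-- selected coordinate (a , b)ₘ are E-related, directly or through a third point; hence e
-- acts on selected coordinates by one map f : ℚ → ℚ, injective because the two coordinates
-- of a point differ. So e is determined by f together with one bit per pair a < b, telling
-- which of the two candidate points is the image of (a , b , 0). Conversely every
-- permutation σ of ℚ with such a choice of bits is an automorphism of 𝔜, and on finitely
-- many points f agrees with a permutation, a product of transpositions. For the homomorphic
-- equivalence, (a , b , m) ↦ (b , a , m + 1) when b < a retracts 𝔛 onto 𝔜.

module Submission where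

open import Defs
open import Data.Bool using (Bool; true; false; not; T; _∨_)
open import Data.Bool.Properties using (∨-comm; T-irrelevant)
open import Data.Empty using (⊥-elim)
open import Data.Fin using (Fin)
open import Data.Fin.Patterns using (0F; 1F; 2F; 3F)
open import Data.List using (List; []; _∷_)
open import Data.List.Relation.Unary.All as All using (All; []; _∷_)
open import Data.Nat using (ℕ) renaming (_+_ to _+ℕ_)
open import Data.Nat.Properties using (+-comm)
open import Data.Product using (Σ; _×_; _,_; proj₁; proj₂)
open import Data.Rational using (ℚ; 1ℚ; _<_; _+_; _⊔_)
open import Data.Rational.Properties
  using (_≟_; _<?_; <-cmp; <-asym; <⇒≢; ≤-<-trans; +-monoʳ-<; +-identityʳ; positive⁻¹; p≤p⊔q; p≤q⊔p)
open import Data.Sum using (_⊎_; inj₁; inj₂)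
open import Function using (_∘_; id)
open import Function.Bundles using (_↔_; Inverse; Injection; mk↔ₛ′; _⇔_; mk⇔; Equivalence)
open import Function.Construct.Composition using (_↔-∘_)
open import Function.Construct.Identity using (↔-id)
open import Function.Construct.Symmetry using (↔-sym)
open import Function.Definitions using (Injective)
open import Function.Properties.Inverse using (↔⇒↣)
open import Relation.Binary using (Rel; Asymmetric; DecidableEquality; tri<; tri≈; tri>)
open import Relation.Binary.PropositionalEquality
open import Relation.Nullary using (Dec; yes; no; does; ¬_)
open import Relation.Nullary.Decidable using (dec-true; dec-false; does-⇔)

module _ {ℓ} {P : Set ℓ} where

  T-does⇒ : (d : Dec P) → T (does d) → P
  T-does⇒ (yes p) _ = p

  ⇒T-does : (d : Dec P) → P → T (does d)
  ⇒T-does (yes _) _ = _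
  ⇒T-does (no ¬p) p = ¬p p

  T-not-does⇒ : (d : Dec P) → T (not (does d)) → ¬ P
  T-not-does⇒ (no ¬p) _ = ¬p

  ⇒T-not-does : (d : Dec P) → ¬ P → T (not (does d))
  ⇒T-not-does (yes p) ¬p = ¬p p
  ⇒T-not-does (no _) _ = _

record IsStrong {A B : Structure} (h : Hom A B) : Set where
  field
    reflect-R : ∀ {x y} → R B (fun h x) (fun h y) → R A x y
    reflect-E : ∀ {x y} → E B (fun h x) (fun h y) → E A x y
    reflect-N : ∀ {x y} → N B (fun h x) (fun h y) → N A x y

strong-bijection⇒Aut : ∀ {A} (h : Hom A A) → IsStrong h → (h⁻¹ : Carrier A → Carrier A) →
                       (∀ x → fun h (h⁻¹ x) ≡ x) → (∀ x → h⁻¹ (fun h x) ≡ x) → Aut A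
strong-bijection⇒Aut {A} h strong h⁻¹ hh⁻¹ h⁻¹h = record
  { to      = h
  ; from    = record
    { fun    = h⁻¹
    ; pres-R = λ r → reflect-R (pull (R A) r)
    ; pres-E = λ r → reflect-E (pull (E A) r)
    ; pres-N = λ r → reflect-N (pull (N A) r)
    }
  ; to∘from = hh⁻¹
  ; from∘to = h⁻¹h
  }
  where
  open IsStrong strong
  pull : ∀ (S : Carrier A → Carrier A → Set) {x y} → S x y → S (fun h (h⁻¹ x)) (fun h (h⁻¹ y))
  pull S {x} {y} = subst₂ S (sym (hh⁻¹ x)) (sym (hh⁻¹ y))

infixr 6 _⊕_
infix 7 ⊖_

_⊕_ : Fin 4 → Fin 4 → Fin 4
0F ⊕ m = m
1F ⊕ m = suc4 m
2F ⊕ m = suc4 (suc4 m)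
3F ⊕ m = suc4 (suc4 (suc4 m))

⊖_ : Fin 4 → Fin 4
⊖ 0F = 0F
⊖ 1F = 3F
⊖ 2F = 2F
⊖ 3F = 1F

suc4-periodic : ∀ m → suc4 (suc4 (suc4 (suc4 m))) ≡ m
suc4-periodic 0F = refl
suc4-periodic 1F = refl
suc4-periodic 2F = refl
suc4-periodic 3F = refl

⊖-inverseˡ : ∀ k m → ⊖ k ⊕ (k ⊕ m) ≡ m
⊖-inverseˡ 0F m = refl
⊖-inverseˡ 1F m = suc4-periodic m
⊖-inverseˡ 2F m = suc4-periodic m
⊖-inverseˡ 3F m = suc4-periodic m

⊖-inverseʳ : ∀ k m → k ⊕ (⊖ k ⊕ m) ≡ m
⊖-inverseʳ 0F m = refl
⊖-inverseʳ 1F m = suc4-periodic m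
⊖-inverseʳ 2F m = suc4-periodic m
⊖-inverseʳ 3F m = suc4-periodic m

⊕-cancelˡ : ∀ k {m n} → k ⊕ m ≡ k ⊕ n → m ≡ n
⊕-cancelˡ k {m} {n} eq = begin
  m              ≡⟨ sym (⊖-inverseˡ k m) ⟩
  ⊖ k ⊕ (k ⊕ m)  ≡⟨ cong (⊖ k ⊕_) eq ⟩
  ⊖ k ⊕ (k ⊕ n)  ≡⟨ ⊖-inverseˡ k n ⟩
  n              ∎
  where open ≡-Reasoning

⊕-suc4 : ∀ k m → suc4 (k ⊕ m) ≡ k ⊕ suc4 m
⊕-suc4 0F m = refl
⊕-suc4 1F m = refl
⊕-suc4 2F m = refl
⊕-suc4 3F m = refl

⊕-comm : ∀ j k → j ⊕ k ≡ k ⊕ j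
⊕-comm 0F 0F = refl
⊕-comm 0F 1F = refl
⊕-comm 0F 2F = refl
⊕-comm 0F 3F = refl
⊕-comm 1F 0F = refl
⊕-comm 1F 1F = refl
⊕-comm 1F 2F = refl
⊕-comm 1F 3F = refl
⊕-comm 2F 0F = refl
⊕-comm 2F 1F = refl
⊕-comm 2F 2F = refl
⊕-comm 2F 3F = refl
⊕-comm 3F 0F = refl
⊕-comm 3F 1F = refl
⊕-comm 3F 2F = refl
⊕-comm 3F 3F = refl

-- m and m ⊕ 2 select the same coordinate; high tells them apart
high : Fin 4 → Bool
high 0F = false
high 1F = false
high 2F = true
high 3F = true

evenIndex : Bool → Fin 4
evenIndex false = 0F
evenIndex true  = 2F

high-evenIndex : ∀ h → high (evenIndex h) ≡ h
high-evenIndex false = refl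
high-evenIndex true  = refl

high-suc4-evenIndex : ∀ h → high (suc4 (evenIndex h)) ≡ h
high-suc4-evenIndex false = refl
high-suc4-evenIndex true  = refl

sel-swap : ∀ a b m → sel b a (suc4 m) ≡ sel a b m
sel-swap a b 0F = refl
sel-swap a b 1F = refl
sel-swap a b 2F = refl
sel-swap a b 3F = refl

sel-suc4² : ∀ a b m → sel a b (suc4 (suc4 m)) ≡ sel a b m
sel-suc4² a b m = trans (sel-swap b a (suc4 m)) (sel-swap a b m)

sel-⊕ : ∀ a b m j → sel a b (m ⊕ j) ≡ sel (sel a b m) (sel a b (suc4 m)) j
sel-⊕ a b 0F j = refl
sel-⊕ a b 1F j = sel-swap b a j
sel-⊕ a b 2F j = sel-suc4² a b j
sel-⊕ a b 3F j = trans (sel-suc4² a b (suc4 j)) (sel-swap b a j)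

sel-map : (π : ℚ → ℚ) → ∀ a b m → sel (π a) (π b) m ≡ π (sel a b m)
sel-map π a b 0F = refl
sel-map π a b 1F = refl
sel-map π a b 2F = refl
sel-map π a b 3F = refl

sel-index-unique : ∀ {a b} → a ≢ b → ∀ m n → sel a b m ≡ sel a b n → high m ≡ high n → m ≡ n
sel-index-unique _ 0F 0F _ _ = refl
sel-index-unique _ 1F 1F _ _ = refl
sel-index-unique _ 2F 2F _ _ = refl
sel-index-unique _ 3F 3F _ _ = refl
sel-index-unique a≢b 0F 1F a≡b _ = ⊥-elim (a≢b a≡b)
sel-index-unique a≢b 1F 0F b≡a _ = ⊥-elim (a≢b (sym b≡a))
sel-index-unique a≢b 2F 3F a≡b _ = ⊥-elim (a≢b a≡b)
sel-index-unique a≢b 3F 2F b≡a _ = ⊥-elim (a≢b (sym b≡a))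
sel-index-unique _ 0F 2F _ ()
sel-index-unique _ 0F 3F _ ()
sel-index-unique _ 1F 2F _ ()
sel-index-unique _ 1F 3F _ ()
sel-index-unique _ 2F 0F _ ()
sel-index-unique _ 2F 1F _ ()
sel-index-unique _ 3F 0F _ ()
sel-index-unique _ 3F 1F _ ()

SamePair : ∀ {a} {A : Set a} → A → A → A → A → Set a
SamePair a b c d = (a ≡ c × b ≡ d) ⊎ (a ≡ d × b ≡ c)

module _ {a} {A : Set a} where

  SamePair-sym : {p q r s : A} → SamePair p q r s → SamePair r s p q
  SamePair-sym (inj₁ (refl , refl)) = inj₁ (refl , refl)
  SamePair-sym (inj₂ (refl , refl)) = inj₂ (refl , refl)

  SamePair-trans : {p q r s t u : A} → SamePair p q r s → SamePair r s t u → SamePair p q t u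
  SamePair-trans (inj₁ (refl , refl)) rs~tu = rs~tu
  SamePair-trans (inj₂ (refl , refl)) (inj₁ (refl , refl)) = inj₂ (refl , refl)
  SamePair-trans (inj₂ (refl , refl)) (inj₂ (refl , refl)) = inj₁ (refl , refl)

  SamePair-map : ∀ {b} {B : Set b} (f : A → B) {p q r s : A} →
                 SamePair p q r s → SamePair (f p) (f q) (f r) (f s)
  SamePair-map f (inj₁ (refl , refl)) = inj₁ (refl , refl)
  SamePair-map f (inj₂ (refl , refl)) = inj₂ (refl , refl)

  SamePair-distinct : {p q r s : A} → r ≢ s → SamePair p q r s → p ≢ q
  SamePair-distinct r≢s (inj₁ (refl , refl)) = r≢s
  SamePair-distinct r≢s (inj₂ (refl , refl)) = r≢s ∘ sym

  SamePair-asym : ∀ {ℓ} {_≺_ : Rel A ℓ} → Asymmetric _≺_ → {p q r s : A} →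
                  p ≺ q → r ≺ s → SamePair p q r s → p ≡ r × q ≡ s
  SamePair-asym asym p≺q r≺s (inj₁ eqs) = eqs
  SamePair-asym asym p≺q r≺s (inj₂ (refl , refl)) = ⊥-elim (asym p≺q r≺s)

selX othX : X → ℚ
selX x = sel (fst₁ x) (snd₁ x) (idx x)
othX x = sel (fst₁ x) (snd₁ x) (suc4 (idx x))

distinct : (x : X) → fst₁ x ≢ snd₁ x
distinct x = T-not-does⇒ (fst₁ x ≟ snd₁ x) (proj₂ x)

mkX : (a b : ℚ) → Fin 4 → a ≢ b → X
mkX a b m a≢b = (a , b , m) , ⇒T-not-does (a ≟ b) a≢b

sel-oth-pair : (x : X) → SamePair (selX x) (othX x) (fst₁ x) (snd₁ x)
sel-oth-pair ((a , b , 0F) , _) = inj₁ (refl , refl)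
sel-oth-pair ((a , b , 1F) , _) = inj₂ (refl , refl)
sel-oth-pair ((a , b , 2F) , _) = inj₁ (refl , refl)
sel-oth-pair ((a , b , 3F) , _) = inj₂ (refl , refl)

selX≢othX : (x : X) → selX x ≢ othX x
selX≢othX x = SamePair-distinct (distinct x) (sel-oth-pair x)

RX-sel-oth : ∀ {x x'} → RX x x' → selX x' ≡ othX x × othX x' ≡ selX x
RX-sel-oth {(a , b , m) , _} {(.a , .b , .(suc4 m)) , _} (refl , refl , refl) = refl , sel-suc4² a b m

common : ℚ → ℚ → ℚ → ℚ → ℕ
common a b c d = count (mem a c d) +ℕ count (mem b c d)

common-swapˡ : ∀ a b c d → common a b c d ≡ common b a c d
common-swapˡ a b c d = +-comm (count (mem a c d)) (count (mem b c d))

common-swapʳ : ∀ a b c d → common a b c d ≡ common a b d c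
common-swapʳ a b c d =
  cong₂ _+ℕ_ (cong count (∨-comm (does (a ≟ c)) _)) (cong count (∨-comm (does (b ≟ c)) _))

common-SamePair : ∀ {s o s' o' a b c d} → SamePair s o a b → SamePair s' o' c d →
                  common s o s' o' ≡ common a b c d
common-SamePair (inj₁ (refl , refl)) (inj₁ (refl , refl)) = refl
common-SamePair {s} {o} (inj₂ (refl , refl)) (inj₁ (refl , refl)) = common-swapˡ s o _ _
common-SamePair {s} {o} {s'} {o'} (inj₁ (refl , refl)) (inj₂ (refl , refl)) = common-swapʳ s o s' o'
common-SamePair {s} {o} {s'} {o'} (inj₂ (refl , refl)) (inj₂ (refl , refl)) =
  trans (common-swapˡ s o s' o') (common-swapʳ o s s' o')

common-injective : ∀ {π : ℚ → ℚ} → Injective _≡_ _≡_ π → ∀ a b c d →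
                   common (π a) (π b) (π c) (π d) ≡ common a b c d
common-injective {π} π-inj a b c d =
  cong₂ _+ℕ_ (cong count (cong₂ _∨_ (≟-map a c) (≟-map a d)))
             (cong count (cong₂ _∨_ (≟-map b c) (≟-map b d)))
  where
  ≟-map : ∀ p q → does (π p ≟ π q) ≡ does (p ≟ q)
  ≟-map p q = does-⇔ (mk⇔ π-inj (cong π)) (π p ≟ π q) (p ≟ q)

common-share-one : ∀ {s o o'} → o ≢ s → o ≢ o' → common s o s o' ≡ 1
common-share-one {s} {o} {o'} o≢s o≢o'
  rewrite dec-true (s ≟ s) refl | dec-false (o ≟ s) o≢s | dec-false (o ≟ o') o≢o' = refl

inter≡common : ∀ x y → inter x y ≡ common (selX x) (othX x) (selX y) (othX y)
inter≡common x y = sym (common-SamePair (sel-oth-pair x) (sel-oth-pair y))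

EX-intro : ∀ x y → selX x ≡ selX y → othX x ≢ othX y → EX x y
EX-intro x y s≡ o≢ = s≡ , (begin
  inter x y                                   ≡⟨ inter≡common x y ⟩
  common (selX x) (othX x) (selX y) (othX y)  ≡⟨ cong (λ s → common (selX x) (othX x) s (othX y)) (sym s≡) ⟩
  common (selX x) (othX x) (selX x) (othX y)  ≡⟨ common-share-one (selX≢othX x ∘ sym) o≢ ⟩
  1                                           ∎)
  where open ≡-Reasoning

record Relabels (π : ℚ → ℚ) (x x' : X) : Set where
  constructor relabels
  field
    sel-relabel : selX x' ≡ π (selX x)
    oth-relabel : othX x' ≡ π (othX x)
open Relabels

module _ {π : ℚ → ℚ} (π-inj : Injective _≡_ _≡_ π) {x y x' y' : X}
         (x↦x' : Relabels π x x') (y↦y' : Relabels π y y') where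

  inter-relabel : inter x' y' ≡ inter x y
  inter-relabel = begin
    inter x' y'                                                 ≡⟨ inter≡common x' y' ⟩
    common (selX x') (othX x') (selX y') (othX y')              ≡⟨ common-cong (sel-relabel x↦x') (oth-relabel x↦x')
                                                                                   (sel-relabel y↦y') (oth-relabel y↦y') ⟩
    common (π (selX x)) (π (othX x)) (π (selX y)) (π (othX y))  ≡⟨ common-injective π-inj _ _ _ _ ⟩
    common (selX x) (othX x) (selX y) (othX y)                  ≡⟨ inter≡common x y ⟨
    inter x y                                                   ∎
    where
    open ≡-Reasoning
    common-cong : ∀ {a a' b b' c c' d d'} → a ≡ a' → b ≡ b' → c ≡ c' → d ≡ d' → common a b c d ≡ common a' b' c' d'
    common-cong refl refl refl refl = refl

  EX-relabel : EX x y ⇔ EX x' y'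
  EX-relabel = mk⇔
    (λ (s≡ , i) → trans (sel-relabel x↦x') (trans (cong π s≡) (sym (sel-relabel y↦y'))) , trans inter-relabel i)
    (λ (s≡ , i) → π-inj (trans (sym (sel-relabel x↦x')) (trans s≡ (sel-relabel y↦y'))) , trans (sym inter-relabel) i)

  NX-relabel : NX x y ⇔ NX x' y'
  NX-relabel = mk⇔ (trans inter-relabel) (trans (sym inter-relabel))

fstY sndY selY othY : Y → ℚ
fstY y = fst₁ (proj₁ y)
sndY y = snd₁ (proj₁ y)
selY y = selX (proj₁ y)
othY y = othX (proj₁ y)

idxY : Y → Fin 4
idxY y = idx (proj₁ y)

ltY : (y : Y) → fstY y < sndY y
ltY y = T-does⇒ (fstY y <? sndY y) (proj₂ y)

mkY : (a b : ℚ) → Fin 4 → a < b → Y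
mkY a b m a<b = mkX a b m (<⇒≢ a<b) , ⇒T-does (a <? b) a<b

Y-≡ : (u v : Y) → fstY u ≡ fstY v → sndY u ≡ sndY v → idxY u ≡ idxY v → u ≡ v
Y-≡ (((a , b , m) , p) , q) (((.a , .b , .m) , p') , q') refl refl refl
  rewrite T-irrelevant p p' | T-irrelevant q q' = refl

-- reuses the proofs of a ≢ b and a < b, so that base (reindex y m) is definitionally base y
reindex : Y → Fin 4 → Y
reindex (((a , b , _) , p) , q) m = ((a , b , m) , p) , q

base : Y → Y
base y = reindex y 0F

base-cong : ∀ y y' → fstY y ≡ fstY y' → sndY y ≡ sndY y' → base y ≡ base y'
base-cong y y' e₁ e₂ = Y-≡ (base y) (base y') e₁ e₂ refl

next : Y → Y
next y = reindex y (suc4 (idxY y))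

next-R : ∀ y → R 𝔜 y (next y)
next-R y = refl , refl , refl

next-unique : ∀ {y y'} → R 𝔜 y y' → y' ≡ next y
next-unique {y} {y'} (e₁ , e₂ , e₃) = Y-≡ y' (next y) (sym e₁) (sym e₂) (sym e₃)

rotate : Y → Fin 4 → Y
rotate u j = reindex u (idxY u ⊕ j)

rotate-sel : ∀ u j → selY (rotate u j) ≡ sel (selY u) (othY u) j
rotate-sel u j = sel-⊕ (fstY u) (sndY u) (idxY u) j

rotate-oth : ∀ u j → othY (rotate u j) ≡ sel (selY u) (othY u) (suc4 j)
rotate-oth u j = trans (cong (sel (fstY u) (sndY u)) (⊕-suc4 (idxY u) j)) (rotate-sel u (suc4 j))

Endpoints : Y → ℚ → ℚ → Set
Endpoints u a b = SamePair (fstY u) (sndY u) a b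

endpoints-sel-oth : ∀ u → Endpoints u (selY u) (othY u)
endpoints-sel-oth u = SamePair-sym (sel-oth-pair (proj₁ u))

endpoints-unique : ∀ u v {a b} → Endpoints u a b → Endpoints v a b → fstY u ≡ fstY v × sndY u ≡ sndY v
endpoints-unique u v u~ab v~ab = SamePair-asym <-asym (ltY u) (ltY v) (SamePair-trans u~ab (SamePair-sym v~ab))

-- The retraction of 𝔛 onto 𝔜

orient : X → Y
orient ((a , b , m) , p) with <-cmp a b
... | tri< a<b _ _ = mkY a b m a<b
... | tri≈ _ a≡b _ = ⊥-elim (T-not-does⇒ (a ≟ b) p a≡b)
... | tri> _ _ b<a = mkY b a (suc4 m) b<a

orient-relabels : ∀ x → Relabels id x (proj₁ (orient x))
orient-relabels ((a , b , m) , p) with <-cmp a b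
... | tri< _ _ _ = relabels refl refl
... | tri≈ _ a≡b _ = ⊥-elim (T-not-does⇒ (a ≟ b) p a≡b)
... | tri> _ _ _ = relabels (sel-swap a b m) (sel-swap a b (suc4 m))

orient-high : ∀ h x → idx x ≡ evenIndex h → high (idxY (orient x)) ≡ h
orient-high h ((a , b , m) , p) refl with <-cmp a b
... | tri< _ _ _ = high-evenIndex h
... | tri≈ _ a≡b _ = ⊥-elim (T-not-does⇒ (a ≟ b) p a≡b)
... | tri> _ _ _ = high-suc4-evenIndex h

orient-R : ∀ {x x'} → RX x x' → RX (proj₁ (orient x)) (proj₁ (orient x'))
orient-R {(a , b , m) , p} {(.a , .b , .(suc4 m)) , _} (refl , refl , refl) with <-cmp a b
... | tri< _ _ _ = refl , refl , refl
... | tri≈ _ a≡b _ = ⊥-elim (T-not-does⇒ (a ≟ b) p a≡b)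
... | tri> _ _ _ = refl , refl , refl

orient-hom : Hom 𝔛 𝔜
orient-hom = record
  { fun    = orient
  ; pres-R = orient-R
  ; pres-E = λ {x} {y} → Equivalence.to (EX-relabel id (orient-relabels x) (orient-relabels y))
  ; pres-N = λ {x} {y} → Equivalence.to (NX-relabel id (orient-relabels x) (orient-relabels y))
  }

inclusion : Hom 𝔜 𝔛
inclusion = record { fun = proj₁ ; pres-R = id ; pres-E = id ; pres-N = id }

point : (s o : ℚ) → s ≢ o → Bool → Y
point s o s≢o h = orient (mkX s o (evenIndex h) s≢o)

point-sel : ∀ s o s≢o h → selY (point s o s≢o h) ≡ s
point-sel s o s≢o false = sel-relabel (orient-relabels (mkX s o 0F s≢o))
point-sel s o s≢o true  = sel-relabel (orient-relabels (mkX s o 2F s≢o))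

point-oth : ∀ s o s≢o h → othY (point s o s≢o h) ≡ o
point-oth s o s≢o false = oth-relabel (orient-relabels (mkX s o 0F s≢o))
point-oth s o s≢o true  = oth-relabel (orient-relabels (mkX s o 2F s≢o))

point-high : ∀ s o s≢o h → high (idxY (point s o s≢o h)) ≡ h
point-high s o s≢o h = orient-high h (mkX s o (evenIndex h) s≢o) refl

endpoints-point : ∀ s o s≢o h → Endpoints (point s o s≢o h) s o
endpoints-point s o s≢o h =
  SamePair-trans (endpoints-sel-oth (point s o s≢o h)) (inj₁ (point-sel s o s≢o h , point-oth s o s≢o h))

Y-≡-sel-oth : (u v : Y) → selY u ≡ selY v → othY u ≡ othY v → high (idxY u) ≡ high (idxY v) → u ≡ v
Y-≡-sel-oth u@(((a , b , m) , _) , _) v@(((c , d , n) , _) , _) s≡ o≡ h≡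
  with endpoints-unique u v (subst₂ (Endpoints u) s≡ o≡ (endpoints-sel-oth u)) (endpoints-sel-oth v)
... | refl , refl = Y-≡ u v refl refl (sel-index-unique (distinct (proj₁ u)) m n s≡ h≡)

-- Automorphisms of 𝔜

module Twisted (σ : ℚ ↔ ℚ) (τ : Y → Bool) where

  open Inverse σ using () renaming (to to σ⁺; from to σ⁻; strictlyInverseˡ to σ⁺∘σ⁻; strictlyInverseʳ to σ⁻∘σ⁺)

  σ⁺-injective : Injective _≡_ _≡_ σ⁺
  σ⁺-injective = Injection.injective (↔⇒↣ σ)

  σ⁻-injective : Injective _≡_ _≡_ σ⁻
  σ⁻-injective = Injection.injective (↔⇒↣ (↔-sym σ))

  σ⁺-distinct : ∀ z → σ⁺ (fstY z) ≢ σ⁺ (sndY z)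
  σ⁺-distinct z = distinct (proj₁ z) ∘ σ⁺-injective

  anchor : Y → Y
  anchor z = point (σ⁺ (fstY z)) (σ⁺ (sndY z)) (σ⁺-distinct z) (τ z)

  anchor-sel : ∀ z → selY (anchor z) ≡ σ⁺ (fstY z)
  anchor-sel z = point-sel (σ⁺ (fstY z)) (σ⁺ (sndY z)) (σ⁺-distinct z) (τ z)

  anchor-oth : ∀ z → othY (anchor z) ≡ σ⁺ (sndY z)
  anchor-oth z = point-oth (σ⁺ (fstY z)) (σ⁺ (sndY z)) (σ⁺-distinct z) (τ z)

  anchor-high : ∀ z → high (idxY (anchor z)) ≡ τ z
  anchor-high z = point-high (σ⁺ (fstY z)) (σ⁺ (sndY z)) (σ⁺-distinct z) (τ z)

  twist : Y → Y
  twist y = rotate (anchor (base y)) (idxY y)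

  anchor-cong : ∀ y y' → fstY y ≡ fstY y' → sndY y ≡ sndY y' → anchor (base y) ≡ anchor (base y')
  anchor-cong y y' e₁ e₂ = cong anchor (base-cong y y' e₁ e₂)

  endpoints-anchor : ∀ z → Endpoints (anchor z) (σ⁺ (fstY z)) (σ⁺ (sndY z))
  endpoints-anchor z = endpoints-point (σ⁺ (fstY z)) (σ⁺ (sndY z)) (σ⁺-distinct z) (τ z)

  twist-relabels : ∀ y → Relabels σ⁺ (proj₁ y) (proj₁ (twist y))
  twist-relabels y = relabels
    (trans (rotate-sel A (idxY y)) (sel-anchor (idxY y)))
    (trans (rotate-oth A (idxY y)) (sel-anchor (suc4 (idxY y))))
    where
    A = anchor (base y)
    sel-anchor : ∀ j → sel (selY A) (othY A) j ≡ σ⁺ (sel (fstY y) (sndY y) j)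
    sel-anchor j = trans (cong₂ (λ s o → sel s o j) (anchor-sel (base y)) (anchor-oth (base y)))
                         (sel-map σ⁺ (fstY y) (sndY y) j)

  twist-R : ∀ {y y'} → R 𝔜 y y' → R 𝔜 (twist y) (twist y')
  twist-R {y} {y'} (e₁ , e₂ , e₃) =
    cong fstY A≡ , cong sndY A≡ ,
    trans (⊕-suc4 (idxY (anchor (base y))) (idxY y)) (cong₂ _⊕_ (cong idxY A≡) e₃)
    where A≡ = anchor-cong y y' e₁ e₂

  twist-reflects-R : ∀ {y y'} → R 𝔜 (twist y) (twist y') → R 𝔜 y y'
  twist-reflects-R {y} {y'} r@(_ , _ , e₃) = e₁ , e₂ , ⊕-cancelˡ k (begin
    k ⊕ suc4 (idxY y)                    ≡⟨ ⊕-suc4 k (idxY y) ⟨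
    suc4 (k ⊕ idxY y)                    ≡⟨ e₃ ⟩
    idxY (anchor (base y')) ⊕ idxY y'    ≡⟨ cong (λ u → idxY u ⊕ idxY y') (anchor-cong y y' e₁ e₂) ⟨
    k ⊕ idxY y'                          ∎)
    where
    open ≡-Reasoning
    k = idxY (anchor (base y))
    y'~oth-sel : SamePair (selY y') (othY y') (othY y) (selY y)
    sel-oth-swapped = RX-sel-oth {proj₁ (twist y)} {proj₁ (twist y')} r
    y'~oth-sel = inj₁
      ( σ⁺-injective (trans (sym (sel-relabel (twist-relabels y'))) (trans (proj₁ sel-oth-swapped) (oth-relabel (twist-relabels y))))
      , σ⁺-injective (trans (sym (oth-relabel (twist-relabels y'))) (trans (proj₂ sel-oth-swapped) (sel-relabel (twist-relabels y)))) )
    endpoints≡ = endpoints-unique y y'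
      (SamePair-trans (endpoints-sel-oth y) (inj₂ (refl , refl)))
      (SamePair-trans (endpoints-sel-oth y') y'~oth-sel)
    e₁ = proj₁ endpoints≡
    e₂ = proj₂ endpoints≡

  twist-hom : Hom 𝔜 𝔜
  twist-hom = record
    { fun    = twist
    ; pres-R = twist-R
    ; pres-E = λ {y} {y'} → Equivalence.to (EX-relabel σ⁺-injective (twist-relabels y) (twist-relabels y'))
    ; pres-N = λ {y} {y'} → Equivalence.to (NX-relabel σ⁺-injective (twist-relabels y) (twist-relabels y'))
    }

  twist-strong : IsStrong twist-hom
  twist-strong = record
    { reflect-R = twist-reflects-R
    ; reflect-E = λ {y} {y'} → Equivalence.from (EX-relabel σ⁺-injective (twist-relabels y) (twist-relabels y'))
    ; reflect-N = λ {y} {y'} → Equivalence.from (NX-relabel σ⁺-injective (twist-relabels y) (twist-relabels y'))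
    }

  preimage : Y → Y
  preimage z = point (σ⁻ (selY z)) (σ⁻ (othY z)) (σ⁻-distinct z) false
    where
    σ⁻-distinct : ∀ z → σ⁻ (selY z) ≢ σ⁻ (othY z)
    σ⁻-distinct z = selX≢othX (proj₁ z) ∘ σ⁻-injective

  endpoints-preimage : ∀ z → Endpoints (preimage z) (σ⁻ (selY z)) (σ⁻ (othY z))
  endpoints-preimage z = endpoints-point (σ⁻ (selY z)) (σ⁻ (othY z)) _ false

  untwist : Y → Y
  untwist z = reindex w (⊖ idxY (anchor (base w)) ⊕ idxY z)
    where w = preimage z

  twist-untwist : ∀ z → twist (untwist z) ≡ z
  twist-untwist z = Y-≡ (twist (untwist z)) z e₁ e₂ (⊖-inverseʳ (idxY A) (idxY z))
    where
    w = preimage z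
    A = anchor (base w)
    A~z : Endpoints A (selY z) (othY z)
    A~z = SamePair-trans (endpoints-anchor (base w))
            (SamePair-trans (SamePair-map σ⁺ (endpoints-preimage z)) (inj₁ (σ⁺∘σ⁻ (selY z) , σ⁺∘σ⁻ (othY z))))
    e₁ = proj₁ (endpoints-unique A z A~z (endpoints-sel-oth z))
    e₂ = proj₂ (endpoints-unique A z A~z (endpoints-sel-oth z))

  untwist-twist : ∀ y → untwist (twist y) ≡ y
  untwist-twist y = Y-≡ (untwist (twist y)) y e₁ e₂ (begin
    ⊖ idxY (anchor (base w)) ⊕ k ⊕ idxY y  ≡⟨ cong (λ u → ⊖ idxY u ⊕ k ⊕ idxY y) (anchor-cong w y e₁ e₂) ⟩
    ⊖ k ⊕ k ⊕ idxY y                      ≡⟨ ⊖-inverseˡ k (idxY y) ⟩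
    idxY y                                ∎)
    where
    open ≡-Reasoning
    w = preimage (twist y)
    k = idxY (anchor (base y))
    w~y : Endpoints w (selY y) (othY y)
    w~y = SamePair-trans (endpoints-preimage (twist y))
            (inj₁ ( trans (cong σ⁻ (sel-relabel (twist-relabels y))) (σ⁻∘σ⁺ (selY y))
                  , trans (cong σ⁻ (oth-relabel (twist-relabels y))) (σ⁻∘σ⁺ (othY y)) ))
    e₁ = proj₁ (endpoints-unique w y w~y (endpoints-sel-oth y))
    e₂ = proj₂ (endpoints-unique w y w~y (endpoints-sel-oth y))

  aut : Aut 𝔜
  aut = strong-bijection⇒Aut twist-hom twist-strong untwist twist-untwist untwist-twist

-- Extending finite injections to permutations

module _ {a} {A : Set a} (_≟ᴬ_ : DecidableEquality A) where

  transpose : A → A → A → A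
  transpose u v z with z ≟ᴬ u
  ... | yes _ = v
  ... | no _ with z ≟ᴬ v
  ...   | yes _ = u
  ...   | no _  = z

  transpose-left : ∀ u v → transpose u v u ≡ v
  transpose-left u v with u ≟ᴬ u
  ... | yes _   = refl
  ... | no u≢u  = ⊥-elim (u≢u refl)

  transpose-right : ∀ u v → transpose u v v ≡ u
  transpose-right u v with v ≟ᴬ u
  ... | yes v≡u = v≡u
  ... | no _ with v ≟ᴬ v
  ...   | yes _   = refl
  ...   | no v≢v  = ⊥-elim (v≢v refl)

  transpose-other : ∀ {u v z} → z ≢ u → z ≢ v → transpose u v z ≡ z
  transpose-other {u} {v} {z} z≢u z≢v with z ≟ᴬ u
  ... | yes z≡u = ⊥-elim (z≢u z≡u)
  ... | no _ with z ≟ᴬ v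
  ...   | yes z≡v = ⊥-elim (z≢v z≡v)
  ...   | no _    = refl

  transpose-involutive : ∀ u v z → transpose u v (transpose u v z) ≡ z
  transpose-involutive u v z = involutive (z ≟ᴬ u) (z ≟ᴬ v)
    where
    involutive : Dec (z ≡ u) → Dec (z ≡ v) → transpose u v (transpose u v z) ≡ z
    involutive (yes refl) _ = trans (cong (transpose z v) (transpose-left z v)) (transpose-right z v)
    involutive (no _) (yes refl) = trans (cong (transpose u z) (transpose-right u z)) (transpose-left u z)
    involutive (no z≢u) (no z≢v) =
      trans (cong (transpose u v) (transpose-other z≢u z≢v)) (transpose-other z≢u z≢v)

  transposition : A → A → A ↔ A
  transposition u v = mk↔ₛ′ (transpose u v) (transpose u v) (transpose-involutive u v) (transpose-involutive u v)

  extend-injection : ∀ {f : A → A} → Injective _≡_ _≡_ f → (P : List A) →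
                     Σ (A ↔ A) λ σ → All (λ p → Inverse.to σ p ≡ f p) P
  extend-injection f-inj [] = ↔-id A , []
  extend-injection {f} f-inj (p ∷ P) with extend-injection f-inj P
  ... | σ , σ≗f = transposition (σ⁺ p) (f p) ↔-∘ σ , transpose-left (σ⁺ p) (f p) ∷ All.map fixed σ≗f
    where
    σ⁺ = Inverse.to σ
    σ⁺-injective = Injection.injective (↔⇒↣ σ)
    fixed : ∀ {q} → σ⁺ q ≡ f q → transpose (σ⁺ p) (f p) (σ⁺ q) ≡ f q
    fixed {q} σq≡fq with f q ≟ᴬ σ⁺ p | f q ≟ᴬ f p
    ... | yes fq≡σp | _ rewrite σ⁺-injective (trans σq≡fq fq≡σp) = transpose-left (σ⁺ p) (f p)
    ... | no fq≢σp | yes fq≡fp rewrite f-inj fq≡fp = ⊥-elim (fq≢σp (sym σq≡fq))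
    ... | no fq≢σp | no fq≢fp rewrite σq≡fq = transpose-other fq≢σp fq≢fp

-- Endomorphisms of 𝔜

above : ∀ p → p < p + 1ℚ
above p = subst (_< p + 1ℚ) (+-identityʳ p) (+-monoʳ-< p (positive⁻¹ 1ℚ))

fresh : (s o : ℚ) → Σ ℚ λ t → s ≢ t × o ≢ t
fresh s o = s ⊔ o + 1ℚ , <⇒≢ (≤-<-trans (p≤p⊔q s o) (above _)) , <⇒≢ (≤-<-trans (p≤q⊔p s o) (above _))

canonical : ℚ → Y
canonical a = point a (a + 1ℚ) (<⇒≢ (above a)) false

canonical-sel : ∀ a → selY (canonical a) ≡ a
canonical-sel a = point-sel a (a + 1ℚ) (<⇒≢ (above a)) false

module Endomorphism (e : Hom 𝔜 𝔜) where

  next-commutes : ∀ u → fun e (next u) ≡ next (fun e u)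
  next-commutes u = next-unique (pres-R e (next-R u))

  rotate-commutes : ∀ u j → fun e (rotate u j) ≡ rotate (fun e u) j
  rotate-commutes u j = begin
    fun e (rotate u j)                      ≡⟨ cong (fun e ∘ reindex u) (⊕-comm (idxY u) j) ⟩
    fun e (reindex u (j ⊕ idxY u))          ≡⟨ iterate j ⟩
    reindex (fun e u) (j ⊕ idxY (fun e u))  ≡⟨ cong (reindex (fun e u)) (⊕-comm j (idxY (fun e u))) ⟩
    rotate (fun e u) j                      ∎
    where
    open ≡-Reasoning
    iterate : ∀ j → fun e (reindex u (j ⊕ idxY u)) ≡ reindex (fun e u) (j ⊕ idxY (fun e u))
    iterate 0F = refl
    iterate 1F = next-commutes u
    iterate 2F = trans (next-commutes (next u)) (cong next (next-commutes u))
    iterate 3F = trans (next-commutes (next (next u)))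
                       (cong next (trans (next-commutes (next u)) (cong next (next-commutes u))))

  sel-cong-apart : ∀ y y' → selY y ≡ selY y' → othY y ≢ othY y' → selY (fun e y) ≡ selY (fun e y')
  sel-cong-apart y y' s≡ o≢ = proj₁ (pres-E e (EX-intro (proj₁ y) (proj₁ y') s≡ o≢))

  -- if y and y' share both coordinates, pass through a point z sharing only the selected one
  sel-cong : ∀ {y y'} → selY y ≡ selY y' → selY (fun e y) ≡ selY (fun e y')
  sel-cong {y} {y'} s≡ with othY y ≟ othY y'
  ... | no o≢ = sel-cong-apart y y' s≡ o≢
  ... | yes o≡ with fresh (selY y) (othY y)
  ...   | t , s≢t , o≢t = trans
    (sel-cong-apart y z (sym z-sel) (λ o≡t → o≢t (trans o≡t z-oth)))
    (sel-cong-apart z y' (trans z-sel s≡) (λ t≡o → o≢t (trans o≡ (trans (sym t≡o) z-oth))))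
    where
    z = point (selY y) t s≢t false
    z-sel : selY z ≡ selY y
    z-sel = point-sel (selY y) t s≢t false
    z-oth : othY z ≡ t
    z-oth = point-oth (selY y) t s≢t false

  f : ℚ → ℚ
  f a = selY (fun e (canonical a))

  sel-commutes : ∀ y → selY (fun e y) ≡ f (selY y)
  sel-commutes y = sel-cong (sym (canonical-sel (selY y)))

  oth-commutes : ∀ y → othY (fun e y) ≡ f (othY y)
  oth-commutes y = trans (cong selY (sym (next-commutes y))) (sel-commutes (next y))

  f-injective : Injective _≡_ _≡_ f
  f-injective {a} {b} fa≡fb with a ≟ b
  ... | yes a≡b = a≡b
  ... | no a≢b = ⊥-elim (selX≢othX (proj₁ (fun e y)) (begin
    selY (fun e y)  ≡⟨ sel-commutes y ⟩
    f (selY y)      ≡⟨ cong f (point-sel a b a≢b false) ⟩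
    f a             ≡⟨ fa≡fb ⟩
    f b             ≡⟨ cong f (point-oth a b a≢b false) ⟨
    f (othY y)      ≡⟨ oth-commutes y ⟨
    othY (fun e y)  ∎))
    where
    open ≡-Reasoning
    y = point a b a≢b false

  τ : Y → Bool
  τ z = high (idxY (fun e z))

  twist-agrees : (σ : ℚ ↔ ℚ) (y : Y) →
                 Inverse.to σ (fstY y) ≡ f (fstY y) → Inverse.to σ (sndY y) ≡ f (sndY y) →
                 Twisted.twist σ τ y ≡ fun e y
  twist-agrees σ y σa≡fa σb≡fb = begin
    rotate (anchor (base y)) (idxY y)    ≡⟨ cong (λ u → rotate u (idxY y)) anchor≡ ⟩
    rotate (fun e (base y)) (idxY y)     ≡⟨ rotate-commutes (base y) (idxY y) ⟨
    fun e y                              ∎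
    where
    open ≡-Reasoning
    open Twisted σ τ using (anchor; anchor-sel; anchor-oth; anchor-high)
    anchor≡ : anchor (base y) ≡ fun e (base y)
    anchor≡ = Y-≡-sel-oth (anchor (base y)) (fun e (base y))
      (trans (anchor-sel (base y)) (trans σa≡fa (sym (sel-commutes (base y)))))
      (trans (anchor-oth (base y)) (trans σb≡fb (sym (oth-commutes (base y)))))
      (anchor-high (base y))

endpoints : List Y → List ℚ
endpoints [] = []
endpoints (y ∷ ys) = fstY y ∷ sndY y ∷ endpoints ys

𝔜-modelCompleteCore : ModelCompleteCore 𝔜
𝔜-modelCompleteCore e ys = Twisted.aut σ τ , agree ys σ≗f
  where
  open Endomorphism e
  σ = proj₁ (extend-injection _≟_ f-injective (endpoints ys))
  σ≗f = proj₂ (extend-injection _≟_ f-injective (endpoints ys))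
  agree : ∀ ys → All (λ p → Inverse.to σ p ≡ f p) (endpoints ys) →
          All (λ y → Twisted.twist σ τ y ≡ fun e y) ys
  agree [] [] = []
  agree (y ∷ ys) (σa≡fa ∷ σb≡fb ∷ rest) = twist-agrees σ y σa≡fa σb≡fb ∷ agree ys rest

corollary4p17 : ModelCompleteCore 𝔜 × HomEquivalent 𝔛 𝔜
corollary4p17 = 𝔜-modelCompleteCore , orient-hom , inclusion
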